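{- Let $p$ be a prime, $e \ge 1$, $\overline{X} = (X_1, \ldots, X_n)$, and let $\mathcal{A}$ be a commutative local $\mathbb{Z}/p^e\mathbb{Z}(\overline{X})$-algebra, finitely generated as a $\mathbb{Z}/p^e\mathbb{Z}(\overline{X})$-module, with maximal ideal $\mathfrak{m}$ satisfying $\mathfrak{m}^t = 0$ for some $t \ge 1$. Let $A_1, \ldots, A_N$ be invertible elements of $\mathcal{A}$. Then $A_1, \ldots, A_N$ are multiplicatively independent in $\mathcal{A}$ if and only if their images are multiplicatively independent in $\mathcal{A}/\mathfrak{m}$.
   Context: $\mathbb{Z}/p^e\mathbb{Z}(\overline{X}) = \{f/g \mid f, g \in \mathbb{Z}/p^e\mathbb{Z}[X_1, \ldots, X_n],\ p \nmid g\}$. Elements $A_1, \ldots, A_N$ are multiplicatively independent if $A_1^{z_1}\cdots A_N^{z_N} = 1$ with $z_i \in \mathbb{Z}$ implies $z_1 = \cdots = z_N = 0$. -}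

module Defs where

open import Level using (Level; _⊔_)
open import Data.Nat as ℕ using (ℕ; zero; suc; _^_)
open import Data.Integer as ℤ using (ℤ; +_; -[1+_])
open import Data.Integer.Divisibility using () renaming (_∣_ to _∣ℤ_)
open import Data.List using (List; []; _∷_; map)
open import Data.List.Relation.Unary.All using (All)
open import Data.Fin using (Fin; zero; suc)
open import Data.Product using (Σ; _×_; _,_; proj₁; proj₂; ∃-syntax)
open import Data.Sum using (_⊎_)
open import Relation.Nullary using (¬_)
open import Relation.Binary.PropositionalEquality using (_≡_)
open import Algebra.Bundles using (CommutativeRing)

-- Polynomials over ℤ in n variables X₁,…,Xₙ, represented recursively:
-- Poly 0 = ℤ, Poly (suc n) = coefficient lists (lowest degree first)
-- in the last variable with coefficients in Poly n.
-- Z/p^eZ[X̄] is Z[X̄] modulo the relation "all coefficients of the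
-- difference are divisible by p^e".

Poly : ℕ → Set
Poly zero    = ℤ
Poly (suc n) = List (Poly n)

record PolyOps (P : Set) : Set where
  field
    zeroP oneP : P
    addP mulP  : P → P → P
    negP       : P → P

listOps : {P : Set} → PolyOps P → PolyOps (List P)
listOps {P} o = record
  { zeroP = []
  ; oneP  = PolyOps.oneP o ∷ []
  ; addP  = addL
  ; mulP  = mulL
  ; negP  = map (PolyOps.negP o)
  }
  where
  addL : List P → List P → List P
  addL []       ys       = ys
  addL (x ∷ xs) []       = x ∷ xs
  addL (x ∷ xs) (y ∷ ys) = PolyOps.addP o x y ∷ addL xs ys
  mulL : List P → List P → List P
  mulL []       ys = []
  mulL (x ∷ xs) ys = addL (map (PolyOps.mulP o x) ys) (PolyOps.zeroP o ∷ mulL xs ys)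

ℤOps : PolyOps ℤ
ℤOps = record { zeroP = + 0 ; oneP = + 1 ; addP = ℤ._+_ ; mulP = ℤ._*_ ; negP = ℤ.-_ }

polyOps : (n : ℕ) → PolyOps (Poly n)
polyOps zero    = ℤOps
polyOps (suc n) = listOps (polyOps n)

AllCoeffs : {n : ℕ} → (ℤ → Set) → Poly n → Set
AllCoeffs {zero}  Q c  = Q c
AllCoeffs {suc n} Q xs = All (AllCoeffs Q) xs

-- The ring Z/p^eZ(X̄) = { f/g | f,g ∈ Z/p^eZ[X̄], p ∤ g }, presented as
-- raw pairs (numerator , denominator) with a validity predicate
-- (p ∤ g) and the equality f/g = f'/g' iff f g' ≡ f' g mod p^e.

Frac : ℕ → Set
Frac n = Poly n × Poly n

module _ {n : ℕ} where
  open PolyOps (polyOps n)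

  ValidFrac : ℕ → Frac n → Set
  ValidFrac p (f , g) = ¬ AllCoeffs (λ c → (+ p) ∣ℤ c) g

  FracEq : ℕ → ℕ → Frac n → Frac n → Set
  FracEq p e (f , g) (f' , g') =
    AllCoeffs (λ c → (+ (p ^ e)) ∣ℤ c) (addP (mulP f g') (negP (mulP f' g)))

  fracAdd : Frac n → Frac n → Frac n
  fracAdd (f , g) (f' , g') = addP (mulP f g') (mulP f' g) , mulP g g'

  fracMul : Frac n → Frac n → Frac n
  fracMul (f , g) (f' , g') = mulP f f' , mulP g g'

  fracOne : Frac n
  fracOne = oneP , oneP

module _ {c ℓ : Level} (A : CommutativeRing c ℓ) where
  open CommutativeRing A hiding (zero)

  sumF : (k : ℕ) → (Fin k → Carrier) → Carrier
  sumF zero    x = 0#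
  sumF (suc k) x = x zero + sumF k (λ i → x (suc i))

  prodF : (k : ℕ) → (Fin k → Carrier) → Carrier
  prodF zero    x = 1#
  prodF (suc k) x = x zero * prodF k (λ i → x (suc i))

  record IsAlgebraMap (p e n : ℕ) (φ : Frac n → Carrier) : Set (c ⊔ ℓ) where
    field
      φ-cong : ∀ a b → ValidFrac p a → ValidFrac p b → FracEq p e a b → φ a ≈ φ b
      φ-+    : ∀ a b → ValidFrac p a → ValidFrac p b → φ (fracAdd a b) ≈ φ a + φ b
      φ-*    : ∀ a b → ValidFrac p a → ValidFrac p b → φ (fracMul a b) ≈ φ a * φ b
      φ-1    : φ fracOne ≈ 1#

  -- A finitely generated as a module via r · x = φ r * x
  FinitelyGenerated : (p n : ℕ) → (Frac n → Carrier) → Set (c ⊔ ℓ)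
  FinitelyGenerated p n φ =
    ∃[ k ] Σ (Fin k → Carrier) λ gens → ∀ x →
      Σ (Fin k → Frac n) λ r → (∀ i → ValidFrac p (r i)) ×
        (x ≈ sumF k (λ i → φ (r i) * gens i))

  Subset : Set (Level.suc (c ⊔ ℓ))
  Subset = Carrier → Set (c ⊔ ℓ)

  record IsIdeal (I : Subset) : Set (c ⊔ ℓ) where
    field
      resp  : ∀ {x y} → x ≈ y → I x → I y
      zero∈ : I 0#
      +∈    : ∀ {x y} → I x → I y → I (x + y)
      *∈    : ∀ a {x} → I x → I (a * x)

  IsMaximalIdeal : Subset → Set (Level.suc (c ⊔ ℓ))
  IsMaximalIdeal I =
    IsIdeal I × ¬ I 1# ×
    (∀ J → IsIdeal J → (∀ x → I x → J x) → (∀ x → J x → I x) ⊎ J 1#)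

  IsLocalWithMaximal : Subset → Set (Level.suc (c ⊔ ℓ))
  IsLocalWithMaximal m =
    IsMaximalIdeal m ×
    (∀ J → IsMaximalIdeal J → (∀ x → J x → m x) × (∀ x → m x → J x))

  IdealPowZero : Subset → ℕ → Set (c ⊔ ℓ)
  IdealPowZero m t = ∀ (x : Fin t → Carrier) → (∀ i → m (x i)) → prodF t x ≈ 0#

  powℕ : Carrier → ℕ → Carrier
  powℕ u zero    = 1#
  powℕ u (suc k) = u * powℕ u k

  -- integer power of a unit u with inverse v
  zpow : Carrier → Carrier → ℤ → Carrier
  zpow u v (+ k)      = powℕ u k
  zpow u v (-[1+ k ]) = powℕ v (suc k)

  Units : (N : ℕ) → (Fin N → Carrier) → Set (c ⊔ ℓ)
  Units N a = ∀ i → Σ Carrier λ b → a i * b ≈ 1#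

  -- multiplicative independence of units a₁..a_N, where the equality
  -- of the ambient ring is given by the relation _~_ (≈ for A itself,
  -- x - y ∈ m for the quotient A/m)
  MultIndep : {ℓ' : Level} → (Carrier → Carrier → Set ℓ') →
              (N : ℕ) → (a : Fin N → Carrier) → Units N a → Set ℓ'
  MultIndep _~_ N a inv =
    ∀ (z : Fin N → ℤ) →
      prodF N (λ i → zpow (a i) (proj₁ (inv i)) (z i)) ~ 1# →
      ∀ i → z i ≡ + 0

  ModEq : Subset → Carrier → Carrier → Set (c ⊔ ℓ)
  ModEq m x y = m (x - y)

{-# OPTIONS --safe #-}
-- If u = A_1^{z_1}⋯A_N^{z_N} is 1 modulo m, write u = 1 + x with x ∈ m, so xᵗ = 0. As A is a
-- Z/p^eZ(X̄)-algebra, q = p^e is 0 in A, so the binomial theorem gives (1 + y)^q = 1 + y²c;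
-- iterating, u^{q^t} = 1 + x^{t+1}c = 1. Hence the exponents q^t z_i give a relation in A, and
-- independence in A forces q^t z_i = 0, i.e. z = 0. Conversely, every relation in A is one in A/m.
module Submission where

open import Defs
open import Level using (_⊔_)
open import Data.Nat using (ℕ; _≤_)
open import Data.Nat.Primality using (Prime)
open import Algebra.Bundles using (CommutativeRing)
open import Function.Bundles using (_⇔_)
open import Data.Fin using (Fin)

open import Data.Nat as ℕ using (zero; suc)
import Data.Nat.Properties as ℕ
import Data.Nat.Divisibility as ℕ
open import Data.Nat.Primality using (¬prime[0]; ¬prime[1])
open import Data.Integer as ℤ using (ℤ; +_)
import Data.Integer.Properties as ℤ
open import Data.Integer.Divisibility using () renaming (_∣_ to _∣ℤ_)
open import Data.Integer.Tactic.RingSolver using (solve-∀)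
open import Data.List using ([]; _∷_)
open import Data.List.Relation.Unary.All using ([]; _∷_)
import Data.Fin as Fin
open import Data.Product using (Σ; _,_; proj₁)
open import Data.Sum using (inj₁; inj₂)
open import Data.Empty using (⊥-elim)
open import Relation.Nullary using (¬_)
open import Relation.Binary.PropositionalEquality as ≡ using (_≡_; _≢_)
open import Function.Bundles using (mk⇔; module Equivalence)
import Algebra.Properties.CommutativeSemiring.Exp as Exp
import Algebra.Definitions.RawMonoid as RawMonoid
import Algebra.Properties.AbelianGroup as AbelianGroupProperties
import Algebra.Solver.Ring.NaturalCoefficients.Default as NaturalSolver

constPoly : (n : ℕ) → ℤ → Poly n
constPoly zero    z = z
constPoly (suc n) z = constPoly n z ∷ []

module PolyOpsₙ (n : ℕ) = PolyOps (polyOps n)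
open PolyOpsₙ

constPoly-+ : ∀ n a b → addP n (constPoly n a) (constPoly n b) ≡ constPoly n (a ℤ.+ b)
constPoly-+ zero    a b = ≡.refl
constPoly-+ (suc n) a b = ≡.cong (_∷ []) (constPoly-+ n a b)

constPoly-+0 : ∀ n a → addP n (constPoly n a) (zeroP n) ≡ constPoly n a
constPoly-+0 zero    a = ℤ.+-identityʳ a
constPoly-+0 (suc n) a = ≡.refl

constPoly-* : ∀ n a b → mulP n (constPoly n a) (constPoly n b) ≡ constPoly n (a ℤ.* b)
constPoly-* zero    a b = ≡.refl
constPoly-* (suc n) a b = ≡.cong (_∷ [])
  (≡.trans (≡.cong (λ c → addP n c (zeroP n)) (constPoly-* n a b)) (constPoly-+0 n (a ℤ.* b)))

constPoly-neg : ∀ n a → negP n (constPoly n a) ≡ constPoly n (ℤ.- a)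
constPoly-neg zero    a = ≡.refl
constPoly-neg (suc n) a = ≡.cong (_∷ []) (constPoly-neg n a)

constPoly-1 : ∀ n → constPoly n (+ 1) ≡ oneP n
constPoly-1 zero    = ≡.refl
constPoly-1 (suc n) = ≡.cong (_∷ []) (constPoly-1 n)

AllCoeffs-constPoly : ∀ n {Q : ℤ → Set} {a} → AllCoeffs Q (constPoly n a) ⇔ Q a
AllCoeffs-constPoly n = mk⇔ (to n) (from n)
  where
  to : ∀ n {Q a} → AllCoeffs Q (constPoly n a) → Q a
  to zero    q        = q
  to (suc n) (q ∷ []) = to n q
  from : ∀ n {Q a} → Q a → AllCoeffs Q (constPoly n a)
  from zero    q = q
  from (suc n) q = from n q ∷ []

constFrac : (n : ℕ) → ℤ → ℤ → Frac n
constFrac n a b = constPoly n a , constPoly n b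

module _ (n : ℕ) where

  ValidFrac-constFrac : ∀ {p} a {b} → ¬ (+ p ∣ℤ b) → ValidFrac p (constFrac n a b)
  ValidFrac-constFrac a p∤b p∣b = p∤b (Equivalence.to (AllCoeffs-constPoly n) p∣b)

  FracEq-constFrac : ∀ p e a b a' b' → + (p ℕ.^ e) ∣ℤ (a ℤ.* b' ℤ.+ ℤ.- (a' ℤ.* b)) →
                     FracEq p e (constFrac n a b) (constFrac n a' b')
  FracEq-constFrac p e a b a' b' q∣ = ≡.subst (AllCoeffs _) (≡.sym numerator≡)
                                    (Equivalence.from (AllCoeffs-constPoly n) q∣)
    where
    open ≡.≡-Reasoning
    numerator≡ : addP n (mulP n (constPoly n a) (constPoly n b'))
                        (negP n (mulP n (constPoly n a') (constPoly n b)))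
                 ≡ constPoly n (a ℤ.* b' ℤ.+ ℤ.- (a' ℤ.* b))
    numerator≡ = begin
      addP n (mulP n (constPoly n a) (constPoly n b')) (negP n (mulP n (constPoly n a') (constPoly n b)))
        ≡⟨ ≡.cong₂ (addP n) (constPoly-* n a b') (≡.cong (negP n) (constPoly-* n a' b)) ⟩
      addP n (constPoly n (a ℤ.* b')) (negP n (constPoly n (a' ℤ.* b)))
        ≡⟨ ≡.cong (addP n _) (constPoly-neg n (a' ℤ.* b)) ⟩
      addP n (constPoly n (a ℤ.* b')) (constPoly n (ℤ.- (a' ℤ.* b)))
        ≡⟨ constPoly-+ n _ _ ⟩
      constPoly n (a ℤ.* b' ℤ.+ ℤ.- (a' ℤ.* b)) ∎

  fracAdd-constFrac : ∀ a b a' b' →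
    fracAdd (constFrac n a b) (constFrac n a' b') ≡ constFrac n (a ℤ.* b' ℤ.+ a' ℤ.* b) (b ℤ.* b')
  fracAdd-constFrac a b a' b' = ≡.cong₂ _,_
    (≡.trans (≡.cong₂ (addP n) (constPoly-* n a b') (constPoly-* n a' b)) (constPoly-+ n _ _))
    (constPoly-* n b b')

  natFrac : ℕ → Frac n
  natFrac k = constFrac n (+ k) (+ 1)

  module _ {p : ℕ} (p≢1 : p ≢ 1) where

    p∤1 : ¬ (+ p ∣ℤ + 1)
    p∤1 p∣1 = p≢1 (ℕ.∣1⇒≡1 p∣1)

    ValidFrac-natFrac : ∀ k → ValidFrac p (natFrac k)
    ValidFrac-natFrac k = ValidFrac-constFrac (+ k) p∤1

    ValidFrac-natFrac-+ : ∀ j k → ValidFrac p (fracAdd (natFrac j) (natFrac k))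
    ValidFrac-natFrac-+ j k = ≡.subst (ValidFrac p) (≡.sym (fracAdd-constFrac (+ j) (+ 1) (+ k) (+ 1)))
                                (ValidFrac-constFrac (+ j ℤ.* + 1 ℤ.+ + k ℤ.* + 1) p∤1)

  natFrac-+ : ∀ p e j k → FracEq p e (natFrac (j ℕ.+ k)) (fracAdd (natFrac j) (natFrac k))
  natFrac-+ p e j k =
    ≡.subst (FracEq p e (natFrac (j ℕ.+ k))) (≡.sym (fracAdd-constFrac (+ j) (+ 1) (+ k) (+ 1)))
      (FracEq-constFrac p e _ _ _ _
        (≡.subst (+ (p ℕ.^ e) ∣ℤ_) (≡.sym (cross≡0 (+ j) (+ k))) (ℕ._∣0 (p ℕ.^ e))))
    where
    cross≡0 : ∀ i j → (i ℤ.+ j) ℤ.* (+ 1 ℤ.* + 1) ℤ.+ ℤ.- ((i ℤ.* + 1 ℤ.+ j ℤ.* + 1) ℤ.* + 1) ≡ + 0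
    cross≡0 = solve-∀

  natFrac-p^e≈0 : ∀ p e → FracEq p e (natFrac (p ℕ.^ e)) (natFrac 0)
  natFrac-p^e≈0 p e =
    FracEq-constFrac p e _ _ _ _ (≡.subst (+ (p ℕ.^ e) ∣ℤ_) (≡.sym (cross≡ (+ (p ℕ.^ e)))) ℕ.∣-refl)
    where
    cross≡ : ∀ i → i ℤ.* + 1 ℤ.+ ℤ.- (+ 0 ℤ.* + 1) ≡ i
    cross≡ = solve-∀

module _ {c ℓ} (A : CommutativeRing c ℓ) where
  open CommutativeRing A
  open Exp commutativeSemiring using (_^_; ^-congˡ; ^-assocʳ; ^-distrib-*)
  open RawMonoid +-rawMonoid using (_×_)
  open AbelianGroupProperties +-abelianGroup using (xyx⁻¹≈y; x≈y⇒x∙y⁻¹≈ε; ∙-cancelˡ)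
  open NaturalSolver commutativeSemiring using (solve; _:=_; _:+_; _:*_; con)
  open import Relation.Binary.Reasoning.Setoid setoid

  1^n≈1 : ∀ n → 1# ^ n ≈ 1#
  1^n≈1 zero    = refl
  1^n≈1 (suc n) = trans (*-identityˡ _) (1^n≈1 n)

  prodF-cong : ∀ N {f g : Fin N → Carrier} → (∀ i → f i ≈ g i) → prodF A N f ≈ prodF A N g
  prodF-cong zero    f≈g = refl
  prodF-cong (suc N) f≈g = *-cong (f≈g Fin.zero) (prodF-cong N (λ i → f≈g (Fin.suc i)))

  prodF-^ : ∀ N (f : Fin N → Carrier) k → prodF A N f ^ k ≈ prodF A N (λ i → f i ^ k)
  prodF-^ zero    f k = 1^n≈1 k
  prodF-^ (suc N) f k = trans (^-distrib-* _ _ k) (*-congˡ (prodF-^ N (λ i → f (Fin.suc i)) k))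

  prodF-const : ∀ t x → prodF A t (λ _ → x) ≈ x ^ t
  prodF-const zero    x = refl
  prodF-const (suc t) x = *-congˡ (prodF-const t x)

  powℕ≈^ : ∀ u k → powℕ A u k ≈ u ^ k
  powℕ≈^ u zero    = refl
  powℕ≈^ u (suc k) = *-congˡ (powℕ≈^ u k)

  zpow-^ : ∀ u v z k → zpow A u v z ^ k ≈ zpow A u v (+ k ℤ.* z)
  zpow-^ u v (+ j)      k       rewrite ≡.sym (ℤ.pos-* k j) = begin
    powℕ A u j ^ k ≈⟨ ^-congˡ k (powℕ≈^ u j) ⟩
    (u ^ j) ^ k    ≈⟨ ^-assocʳ u j k ⟩
    u ^ (j ℕ.* k)  ≡⟨ ≡.cong (u ^_) (ℕ.*-comm j k) ⟩
    u ^ (k ℕ.* j)  ≈⟨ powℕ≈^ u (k ℕ.* j) ⟨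
    powℕ A u (k ℕ.* j) ∎
  zpow-^ u v ℤ.-[1+ j ] zero    = refl
  zpow-^ u v ℤ.-[1+ j ] (suc k) = begin
    powℕ A v (suc j) ^ suc k   ≈⟨ ^-congˡ (suc k) (powℕ≈^ v (suc j)) ⟩
    (v ^ suc j) ^ suc k        ≈⟨ ^-assocʳ v (suc j) (suc k) ⟩
    v ^ (suc j ℕ.* suc k)      ≡⟨ ≡.cong (v ^_) (ℕ.*-comm (suc j) (suc k)) ⟩
    v ^ (suc k ℕ.* suc j)      ≈⟨ powℕ≈^ v (suc k ℕ.* suc j) ⟨
    powℕ A v (suc k ℕ.* suc j) ∎

  [1+y]^n≈1+n·y+y²c : ∀ y n → Σ Carrier λ c → (1# + y) ^ n ≈ 1# + ((n × 1#) * y + y * y * c)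
  [1+y]^n≈1+n·y+y²c y zero    =
    0# , solve 1 (λ y → con 1 := con 1 :+ (con 0 :* y :+ y :* y :* con 0)) refl y
  [1+y]^n≈1+n·y+y²c y (suc n) with [1+y]^n≈1+n·y+y²c y n
  ... | c , [1+y]^n≈ = c + n × 1# + y * c , (begin
    (1# + y) * (1# + y) ^ n                               ≈⟨ *-congˡ [1+y]^n≈ ⟩
    (1# + y) * (1# + ((n × 1#) * y + y * y * c))           ≈⟨ expand y (n × 1#) c ⟩
    1# + ((1# + n × 1#) * y + y * y * (c + n × 1# + y * c)) ∎)
    where
    expand : ∀ y k c → (1# + y) * (1# + (k * y + y * y * c)) ≈ 1# + ((1# + k) * y + y * y * (c + k + y * c))
    expand = solve 3 (λ y k c → (con 1 :+ y) :* (con 1 :+ (k :* y :+ y :* y :* c))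
                                := con 1 :+ ((con 1 :+ k) :* y :+ y :* y :* (c :+ k :+ y :* c))) refl

  module _ {q : ℕ} (q·1≈0 : q × 1# ≈ 0#) where

    [1+y]^q≈1+y²c : ∀ y → Σ Carrier λ c → (1# + y) ^ q ≈ 1# + y * y * c
    [1+y]^q≈1+y²c y with [1+y]^n≈1+n·y+y²c y q
    ... | c , [1+y]^q≈ = c , (begin
      (1# + y) ^ q                          ≈⟨ [1+y]^q≈ ⟩
      1# + ((q × 1#) * y + y * y * c)       ≈⟨ +-congˡ (+-congʳ (trans (*-congʳ q·1≈0) (zeroˡ y))) ⟩
      1# + (0# + y * y * c)                 ≈⟨ +-congˡ (+-identityˡ _) ⟩
      1# + y * y * c                        ∎)

    [1+x]^qᵏ≈1+xᵏ⁺¹c : ∀ x k → Σ Carrier λ c → (1# + x) ^ (q ℕ.^ k) ≈ 1# + x ^ suc k * c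
    [1+x]^qᵏ≈1+xᵏ⁺¹c x zero    =
      1# , solve 1 (λ x → (con 1 :+ x) :* con 1 := con 1 :+ (x :* con 1) :* con 1) refl x
    [1+x]^qᵏ≈1+xᵏ⁺¹c x (suc k) with [1+x]^qᵏ≈1+xᵏ⁺¹c x k
    ... | c , [1+x]^qᵏ≈ with [1+y]^q≈1+y²c (x ^ suc k * c)
    ... | c' , [1+y]^q≈ = x ^ k * c * c * c' , (begin
      (1# + x) ^ (q ℕ.* q ℕ.^ k)      ≡⟨ ≡.cong ((1# + x) ^_) (ℕ.*-comm q (q ℕ.^ k)) ⟩
      (1# + x) ^ (q ℕ.^ k ℕ.* q)      ≈⟨ ^-assocʳ (1# + x) (q ℕ.^ k) q ⟨
      ((1# + x) ^ (q ℕ.^ k)) ^ q      ≈⟨ ^-congˡ q [1+x]^qᵏ≈ ⟩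
      (1# + x ^ suc k * c) ^ q        ≈⟨ [1+y]^q≈ ⟩
      1# + (x * x ^ k * c) * (x * x ^ k * c) * c' ≈⟨ +-congˡ (regroup x (x ^ k) c c') ⟩
      1# + x ^ suc (suc k) * (x ^ k * c * c * c') ∎)
      where
      regroup : ∀ x X c c' → (x * X * c) * (x * X * c) * c' ≈ (x * (x * X)) * (X * c * c * c')
      regroup = solve 4 (λ x X c c' → (x :* X :* c) :* (x :* X :* c) :* c'
                                      := (x :* (x :* X)) :* (X :* c :* c :* c')) refl

    [u-1]ᵗ≈0⇒u^qᵗ≈1 : ∀ u t → (u - 1#) ^ t ≈ 0# → u ^ (q ℕ.^ t) ≈ 1#
    [u-1]ᵗ≈0⇒u^qᵗ≈1 u t xᵗ≈0 with [1+x]^qᵏ≈1+xᵏ⁺¹c (u - 1#) t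
    ... | c , [1+x]^qᵗ≈ = begin
      u ^ (q ℕ.^ t)                 ≈⟨ ^-congˡ (q ℕ.^ t) 1+x≈u ⟨
      (1# + x) ^ (q ℕ.^ t)          ≈⟨ [1+x]^qᵗ≈ ⟩
      1# + x * x ^ t * c            ≈⟨ +-congˡ (trans (*-congʳ (trans (*-congˡ xᵗ≈0) (zeroʳ x))) (zeroˡ c)) ⟩
      1# + 0#                       ≈⟨ +-identityʳ 1# ⟩
      1#                            ∎
      where
      x = u - 1#
      1+x≈u : 1# + x ≈ u
      1+x≈u = trans (sym (+-assoc 1# u (- 1#))) (xyx⁻¹≈y 1# u)

  module _ {p e n : ℕ} {φ : Frac n → Carrier} (φ-alg : IsAlgebraMap A p e n φ) (p≢1 : p ≢ 1) where
    open IsAlgebraMap φ-alg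

    φ-natFrac-+ : ∀ j k → φ (natFrac n (j ℕ.+ k)) ≈ φ (natFrac n j) + φ (natFrac n k)
    φ-natFrac-+ j k = begin
      φ (natFrac n (j ℕ.+ k))                   ≈⟨ φ-cong _ _ (ValidFrac-natFrac n p≢1 (j ℕ.+ k))
                                                     (ValidFrac-natFrac-+ n p≢1 j k) (natFrac-+ n p e j k) ⟩
      φ (fracAdd (natFrac n j) (natFrac n k))   ≈⟨ φ-+ _ _ (ValidFrac-natFrac n p≢1 j)
                                                         (ValidFrac-natFrac n p≢1 k) ⟩
      φ (natFrac n j) + φ (natFrac n k)         ∎

    φ-natFrac-1 : φ (natFrac n 1) ≈ 1#
    φ-natFrac-1 = ≡.subst (λ one → φ (one , one) ≈ 1#) (≡.sym (constPoly-1 n)) φ-1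

    φ-natFrac : ∀ k → φ (natFrac n k) ≈ k × 1#
    φ-natFrac zero    = ∙-cancelˡ φ0 φ0 0# (trans (sym (φ-natFrac-+ 0 0)) (sym (+-identityʳ φ0)))
      where φ0 = φ (natFrac n 0)
    φ-natFrac (suc k) = trans (φ-natFrac-+ 1 k) (+-cong φ-natFrac-1 (φ-natFrac k))

    p^e·1≈0 : (p ℕ.^ e) × 1# ≈ 0#
    p^e·1≈0 = begin
      (p ℕ.^ e) × 1#          ≈⟨ φ-natFrac (p ℕ.^ e) ⟨
      φ (natFrac n (p ℕ.^ e)) ≈⟨ φ-cong _ _ (ValidFrac-natFrac n p≢1 (p ℕ.^ e)) (ValidFrac-natFrac n p≢1 0)
                                   (natFrac-p^e≈0 n p e) ⟩
      φ (natFrac n 0)         ≈⟨ φ-natFrac 0 ⟩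
      0#                      ∎

  IdealPowZero⇒xᵗ≈0 : ∀ {m t x} → IdealPowZero A m t → m x → x ^ t ≈ 0#
  IdealPowZero⇒xᵗ≈0 {t = t} {x} mᵗ≈0 x∈m =
    trans (sym (prodF-const t x)) (mᵗ≈0 (λ _ → x) (λ _ → x∈m))

  module _ {m : Subset A} (N : ℕ) (a : Fin N → Carrier) (inv : Units A N a) where

    MultIndep-mod⇒MultIndep : IsIdeal A m → MultIndep A (ModEq A m) N a inv → MultIndep A _≈_ N a inv
    MultIndep-mod⇒MultIndep m-ideal indep z rel = indep z (resp (sym (x≈y⇒x∙y⁻¹≈ε rel)) zero∈)
      where open IsIdeal m-ideal

    MultIndep⇒MultIndep-mod : ∀ {q t} → q ≢ 0 → q × 1# ≈ 0# → (∀ {x} → m x → x ^ t ≈ 0#) →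
                              MultIndep A _≈_ N a inv → MultIndep A (ModEq A m) N a inv
    MultIndep⇒MultIndep-mod {q} {t} q≢0 q·1≈0 nil indep z rel i
      with ℤ.i*j≡0⇒i≡0∨j≡0 (+ Q) (indep (λ j → + Q ℤ.* z j) rel^Q i)
      where
      Q = q ℕ.^ t
      aᶻ : Fin N → ℤ → Carrier
      aᶻ j k = zpow A (a j) (proj₁ (inv j)) k
      rel^Q : prodF A N (λ j → aᶻ j (+ Q ℤ.* z j)) ≈ 1#
      rel^Q = begin
        prodF A N (λ j → aᶻ j (+ Q ℤ.* z j)) ≈⟨ prodF-cong N (λ j → zpow-^ (a j) _ (z j) Q) ⟨
        prodF A N (λ j → aᶻ j (z j) ^ Q)    ≈⟨ prodF-^ N _ Q ⟨
        prodF A N (λ j → aᶻ j (z j)) ^ Q    ≈⟨ [u-1]ᵗ≈0⇒u^qᵗ≈1 q·1≈0 _ t (nil rel) ⟩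
        1#                                  ∎
    ... | inj₁ Q≡0  = ⊥-elim (q≢0 (ℕ.m^n≡0⇒m≡0 q t (ℤ.+-injective Q≡0)))
    ... | inj₂ zᵢ≡0 = zᵢ≡0

lemma3p33 : ∀ {c ℓ} (p : ℕ) → Prime p → (e : ℕ) → 1 ≤ e → (n : ℕ) →
    (A : CommutativeRing c ℓ) →
    (φ : Frac n → CommutativeRing.Carrier A) → IsAlgebraMap A p e n φ →
    FinitelyGenerated A p n φ →
    (m : CommutativeRing.Carrier A → Set (c ⊔ ℓ)) → IsLocalWithMaximal A m →
    (t : ℕ) → 1 ≤ t → IdealPowZero A m t →
    (N : ℕ) (a : Fin N → CommutativeRing.Carrier A) (inv : Units A N a) →
    MultIndep A (CommutativeRing._≈_ A) N a inv ⇔ MultIndep A (ModEq A m) N a inv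
lemma3p33 p p-prime e _ n A φ φ-alg _ m ((m-ideal , _) , _) t _ mᵗ≈0 N a inv =
  mk⇔ (MultIndep⇒MultIndep-mod A {m} N a inv {t = t} p^e≢0 (p^e·1≈0 A φ-alg p≢1)
         (IdealPowZero⇒xᵗ≈0 A {m} {t} mᵗ≈0))
      (MultIndep-mod⇒MultIndep A {m} N a inv m-ideal)
  where
  p≢1 : p ≢ 1
  p≢1 p≡1 = ¬prime[1] (≡.subst Prime p≡1 p-prime)
  p^e≢0 : p ℕ.^ e ≢ 0
  p^e≢0 p^e≡0 = ¬prime[0] (≡.subst Prime (ℕ.m^n≡0⇒m≡0 p e p^e≡0) p-prime)
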